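{- ${\tt BBWT}(u_k)= \text{\tt \&}_k\,\mathtt{a}^{2k-1}\,\text{\tt \#}_1(\prod_{i=2}^k\mathtt{b}\,\text{\tt \#}_i)\,\mathtt{a}\,(\prod_{i=1}^{k-1} \text{\tt \&}_{i})\,\mathtt{b}$ and $r_B(u_k) = 3k+2$.
   Context: Let $k\ge 1$ and let $\Sigma = \{\mathtt{a},\mathtt{b}\} \cup \bigcup_{i\in[1,k]} \{\text{\tt \#}_i,\text{\tt \&}_i\}$ be ordered as $\text{\tt \#}_1< \text{\tt \&}_1 < \text{\tt \#}_2 < \text{\tt \&}_2 < \dots < \text{\tt \#}_k < \text{\tt \&}_k < \mathtt{a} < \mathtt{b}$. Define $u_k = \prod_{i=1}^k \mathtt{b}\,\mathtt{a}\,\text{\tt \#}_i\,\mathtt{a}\,\text{\tt \&}_i$. The bijective Burrows–Wheeler transform ${\tt BBWT}(w)$ is obtained by taking all rotations of all factors of the Lyndon factorization of $w$, sorting them in $\omega$-order ($x<_\omega y$ iff the infinite power $x^\omega$ is lexicographically smaller than $y^\omega$), and concatenating their last characters; $r_B(w)$ is the number of runs (maximal equal-symbol blocks) in ${\tt BBWT}(w)$. The Lyndon factorization of $u_k$ is $(\mathtt{b},\mathtt{a},\text{\tt \#}_1\mathtt{a}\text{\tt \&}_1\prod_{i=2}^k\mathtt{b}\mathtt{a}\text{\tt \#}_i\mathtt{a}\text{\tt \&}_i)$. -}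

module Defs where

open import Data.Nat using (ℕ; zero; suc; _+_; _*_; _<_; _%_)
open import Data.Fin using (Fin; toℕ; fromℕ; inject₁) renaming (zero to fzero; suc to fsuc)
import Data.Fin as Fin
open import Data.List using (List; []; _∷_; _++_; length; drop; take; map; concat; concatMap; upTo; allFin; replicate; last)
open import Data.List.Relation.Unary.All using (All)
open import Data.List.Relation.Unary.Linked using (Linked)
open import Data.List.Relation.Binary.Permutation.Propositional using (_↭_)
open import Data.Maybe using (Maybe; just; nothing)
open import Data.Product using (Σ; ∃; _×_; _,_)
open import Data.Sum using (_⊎_)
open import Relation.Nullary using (¬_; yes; no)
open import Relation.Binary.PropositionalEquality using (_≡_)

-- Alphabet for parameter k: #_i = hash i, &_i = amp i (i : Fin k, index 0 ↔ i = 1), a, b.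
data Sym (k : ℕ) : Set where
  hash amp : Fin k → Sym k
  a b : Sym k

-- Order  #_1 < &_1 < ... < #_k < &_k < a < b , realised through a rank.
rank : ∀ {k} → Sym k → ℕ
rank (hash i) = 2 * toℕ i
rank (amp i) = suc (2 * toℕ i)
rank {k} a = 2 * k
rank {k} b = suc (2 * k)

_<S_ : ∀ {k} → Sym k → Sym k → Set
c <S d = rank c < rank d

Word : ℕ → Set
Word k = List (Sym k)

data _<ₗ_ {k : ℕ} : Word k → Word k → Set where
  []<∷ : ∀ {y ys} → [] <ₗ (y ∷ ys)
  hd< : ∀ {x y xs ys} → x <S y → (x ∷ xs) <ₗ (y ∷ ys)
  tl< : ∀ {x xs ys} → xs <ₗ ys → (x ∷ xs) <ₗ (x ∷ ys)

rotate : ∀ {k} → ℕ → Word k → Word k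
rotate i w = drop i w ++ take i w

IsLyndon : ∀ {k} → Word k → Set
IsLyndon w = ¬ (w ≡ []) × (∀ i → 0 < i → i < length w → w <ₗ rotate i w)

IsLyndonFactorization : ∀ {k} → List (Word k) → Word k → Set
IsLyndonFactorization fs w =
  concat fs ≡ w × All IsLyndon fs × Linked (λ x y → ¬ (x <ₗ y)) fs

nth : ∀ {k} → Word k → ℕ → Maybe (Sym k)
nth [] _ = nothing
nth (x ∷ xs) zero = just x
nth (x ∷ xs) (suc n) = nth xs n

-- the infinite power x^ω, as a function of the position (nothing for x = [])
omega : ∀ {k} → Word k → ℕ → Maybe (Sym k)
omega [] _ = nothing
omega (c ∷ cs) n = nth (c ∷ cs) (n % suc (length cs))

_≤ω_ : ∀ {k} → Word k → Word k → Set
x ≤ω y = (∀ i → omega x i ≡ omega y i)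
       ⊎ Σ ℕ (λ n → (∀ i → i < n → omega x i ≡ omega y i)
                 × Σ _ (λ c → Σ _ (λ d → omega x n ≡ just c × omega y n ≡ just d × c <S d)))

rotations : ∀ {k} → Word k → List (Word k)
rotations f = map (λ i → rotate i f) (upTo (length f))

IsBBWT : ∀ {k} → Word k → Word k → Set
IsBBWT {k} w out = Σ (List (Word k)) λ fs → Σ (List (Word k)) λ L →
  IsLyndonFactorization fs w × L ↭ concatMap rotations fs × Linked _≤ω_ L
  × map last L ≡ map just out

open import Data.Bool using (Bool; true; false; if_then_else_)
_==_ : ∀ {k} → Sym k → Sym k → Bool
hash i == hash j with i Fin.≟ j
... | yes _ = true
... | no _ = false
amp i == amp j with i Fin.≟ j
... | yes _ = true
... | no _ = false
a == a = true
b == b = true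
_ == _ = false

runs : ∀ {k} → Word k → ℕ
runs [] = 0
runs (x ∷ []) = 1
runs (x ∷ y ∷ rest) = (if x == y then 0 else 1) + runs (y ∷ rest)

u : (m : ℕ) → Word (suc m)
u m = concatMap (λ i → b ∷ a ∷ hash i ∷ a ∷ amp i ∷ []) (allFin (suc m))

-- &_k a^{2k-1} #_1 (∏_{i=2}^k b #_i) a (∏_{i=1}^{k-1} &_i) b   for k = suc m
expectedBBWT : (m : ℕ) → Word (suc m)
expectedBBWT m =
  amp (fromℕ m) ∷ replicate (suc (2 * m)) a
  ++ hash fzero ∷ concatMap (λ i → b ∷ hash (fsuc i) ∷ []) (allFin m)
  ++ a ∷ map (λ i → amp (inject₁ i)) (allFin m)
  ++ b ∷ []

{-# OPTIONS --safe #-}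
module Submission where

-- Write u = b · a · v with v = #₁ a &₁ ∏_{i ≥ 2} b a #ᵢ a &ᵢ. The first letter #₁ of v is strictly
-- smaller than all its other letters, so v is Lyndon and has no finer Lyndon factorization, while the
-- descents b > a > #₁ force the factors b and a in front: (b, a, v) is the unique Lyndon factorization.
-- Each rotation of v is placed in ω-order by at most three letters: first the rotations starting with
-- some #ᵢ or &ᵢ, in the order of that letter; then those starting with a, by their second letter,
-- followed by a^ω; then the rotations b a #ᵢ …, by #ᵢ, followed by b^ω. Reading off last letters gives
-- the stated word, and the sorted list is unique since distinct conjugates of the factors are never
-- ω-equivalent. In that word adjacent letters differ except inside a^{2k-1}, whence 3k + 2 runs.

open import Defs
open import Data.Bool using (true; false)
import Data.Fin as Fin
open import Data.Fin using (Fin; toℕ; fromℕ; inject₁) renaming (zero to fzero; suc to fsuc)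
open import Data.Fin.Properties using (toℕ<n; toℕ-inject₁)
open import Data.List
  using ( List; []; _∷_; _++_; [_]; length; drop; take; map; concat; concatMap; tabulate; replicate
        ; applyUpTo; upTo; allFin; last)
open import Data.List.Properties
  using ( ∷-injectiveˡ; ∷-injectiveʳ; length-++; length-map; length-++-≤ˡ; length-take; length-tabulate
        ; ++-assoc; ++-identityʳ; take++drop≡id; map-tabulate; map-upTo; map-injective)
open import Data.List.Membership.Propositional using (_∈_; _∉_)
open import Data.List.Membership.Propositional.Properties using (∈-++⁺ʳ; ∈-map⁻)
open import Data.List.Relation.Unary.Any using (here; there)
open import Data.List.Relation.Unary.All using (All; []; _∷_)
import Data.List.Relation.Unary.All as All
import Data.List.Relation.Unary.All.Properties as All
import Data.List.Relation.Unary.AllPairs as AllPairs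
import Data.List.Relation.Unary.AllPairs.Properties as AllPairs
open import Data.List.Relation.Unary.Linked using (Linked; []; [-]; _∷_)
import Data.List.Relation.Unary.Linked as Linked
open import Data.List.Relation.Unary.Linked.Properties using (Linked⇒AllPairs; AllPairs⇒Linked)
open import Data.List.Relation.Binary.Pointwise using (Pointwise; []; _∷_; Pointwise-≡⇒≡)
import Data.List.Relation.Binary.Pointwise as Pointwise
open import Data.List.Relation.Binary.Permutation.Propositional
  using (_↭_; ↭-refl; ↭-sym; ↭-trans; ↭-reflexive; module PermutationReasoning)
open import Data.List.Relation.Binary.Permutation.Propositional.Properties
  using (++-comm; ++⁺ˡ; ↭-length; ∈-resp-↭; drop-∷; ↭-empty-inv; ¬x∷xs↭[]; ++-commutativeMonoid)
open import Data.Maybe using (just)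
open import Data.Maybe.Properties using (just-injective)
open import Data.Nat using (ℕ; zero; suc; _+_; _*_; _%_; _<_; _≤_; s≤s; z<s; s<s; _≤?_)
open import Data.Nat.Properties
  using (<-trans; <-≤-trans; <-irrefl; <-asym; <-cmp; n<1+n; +-suc; *-suc; *-monoʳ-≤; m≤n⇒m⊓n≡m; suc-injective)
open import Data.Nat.DivMod using (m<n⇒m%n≡m)
open import Data.Nat.Solver using (module +-*-Solver)
open import Data.Product using (∃-syntax; ∃₂; _×_; _,_; proj₂)
open import Data.Sum using (_⊎_; inj₁; inj₂)
open import Function using (_∘_; id)
open import Relation.Binary.Definitions using (Transitive; tri<; tri≈; tri>)
open import Relation.Binary.PropositionalEquality
  using (_≡_; _≢_; refl; sym; trans; cong; cong₂; subst; subst₂; module ≡-Reasoning)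
open import Relation.Nullary using (¬_; yes; no; contradiction)
open import Relation.Nullary.Decidable using (True; toWitness)

module _ {A : Set} where

  drop-length-++ : ∀ (xs : List A) {ys} → drop (length xs) (xs ++ ys) ≡ ys
  drop-length-++ [] = refl
  drop-length-++ (_ ∷ xs) = drop-length-++ xs

  take-length-++ : ∀ (xs : List A) {ys} → take (length xs) (xs ++ ys) ≡ xs
  take-length-++ [] = refl
  take-length-++ (x ∷ xs) = cong (x ∷_) (take-length-++ xs)

  last-++ : ∀ (xs : List A) {ys} → ys ≢ [] → last (xs ++ ys) ≡ last ys
  last-++ [] _ = refl
  last-++ (_ ∷ []) {[]} ys≢[] = contradiction refl ys≢[]
  last-++ (_ ∷ []) {_ ∷ _} _ = refl
  last-++ (_ ∷ x ∷ xs) ys≢[] = last-++ (x ∷ xs) ys≢[]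

  applyUpTo-blocks↭ : ∀ (g : ℕ → A) n →
    applyUpTo g (n * 5) ↭
      concat (tabulate {n = n} (λ j → g (toℕ j * 5 + 2) ∷ g (toℕ j * 5 + 4) ∷ []))
      ++ concat (tabulate {n = n} (λ j → g (toℕ j * 5 + 1) ∷ g (toℕ j * 5 + 3) ∷ []))
      ++ tabulate {n = n} (λ j → g (toℕ j * 5 + 0))
  applyUpTo-blocks↭ g zero = ↭-refl
  applyUpTo-blocks↭ g (suc n) =
    ↭-trans (++⁺ˡ (applyUpTo g 5) (applyUpTo-blocks↭ (λ x → g (5 + x)) n))
      (solve 8 (λ g₀ g₁ g₂ g₃ g₄ X Y Z →
                  g₀ ⊕ g₁ ⊕ g₂ ⊕ g₃ ⊕ g₄ ⊕ X ⊕ Y ⊕ Z ⊜ (g₂ ⊕ g₄ ⊕ X) ⊕ (g₁ ⊕ g₃ ⊕ Y) ⊕ (g₀ ⊕ Z))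
             ↭-refl [ g 0 ] [ g 1 ] [ g 2 ] [ g 3 ] [ g 4 ] _ _ _)
    where open import Algebra.Solver.CommutativeMonoid (++-commutativeMonoid {A = A}) using (solve; _⊕_; _⊜_)

  concat-pairs≡replicate : ∀ n (x : A) → concat (tabulate {n = n} (λ _ → x ∷ x ∷ [])) ≡ replicate (2 * n) x
  concat-pairs≡replicate zero x = refl
  concat-pairs≡replicate (suc n) x =
    trans (cong (λ xs → x ∷ x ∷ xs) (concat-pairs≡replicate n x)) (cong (λ l → replicate l x) (sym (*-suc 2 n)))

  module _ {R : A → A → Set} where

    linked-pairs : ∀ {n} (f g : Fin n → A) {x ys} →
      (∀ j → R x (f j)) → (∀ j → R (f j) (g j)) → (∀ {i j} → i Fin.< j → R (g i) (f j)) →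
      Linked R (x ∷ ys) → (∀ j → Linked R (g j ∷ ys)) →
      Linked R (x ∷ concat (tabulate (λ j → f j ∷ g j ∷ [])) ++ ys)
    linked-pairs {zero} _ _ _ _ _ x∷ys _ = x∷ys
    linked-pairs {suc n} f g x<f f<g g<f _ g∷ys =
      x<f fzero ∷ f<g fzero ∷
      linked-pairs (f ∘ fsuc) (g ∘ fsuc) (λ _ → g<f z<s) (f<g ∘ fsuc) (λ i<j → g<f (s<s i<j))
        (g∷ys fzero) (g∷ys ∘ fsuc)

    linked-singles : ∀ {n} (f : Fin n → A) {x ys} →
      (∀ j → R x (f j)) → (∀ {i j} → i Fin.< j → R (f i) (f j)) →
      Linked R (x ∷ ys) → (∀ j → Linked R (f j ∷ ys)) →
      Linked R (x ∷ tabulate f ++ ys)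
    linked-singles {zero} _ _ _ x∷ys _ = x∷ys
    linked-singles {suc n} f x<f f<f _ f∷ys =
      x<f fzero ∷ linked-singles (f ∘ fsuc) (λ _ → f<f z<s) (λ i<j → f<f (s<s i<j)) (f∷ys fzero) (f∷ys ∘ fsuc)

    module _ (R-trans : Transitive R) where

      linked-head : ∀ {x xs z} → Linked R (x ∷ xs) → z ∈ x ∷ xs → z ≡ x ⊎ R x z
      linked-head _ (here z≡x) = inj₁ z≡x
      linked-head x∷xs (there z∈xs) with Linked⇒AllPairs R-trans x∷xs
      ... | x<xs AllPairs.∷ _ = inj₂ (All.lookup x<xs z∈xs)

      linked-↭-unique : ∀ {xs ys} → (∀ {x y} → x ∈ xs → y ∈ xs → R x y → R y x → x ≡ y) →
        xs ↭ ys → Linked R xs → Linked R ys → xs ≡ ys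
      linked-↭-unique {[]} _ xs↭ys _ _ = sym (↭-empty-inv (↭-sym xs↭ys))
      linked-↭-unique {_ ∷ _} {[]} _ xs↭ys _ _ = contradiction xs↭ys ¬x∷xs↭[]
      linked-↭-unique {x ∷ xs} {y ∷ ys} antisym x∷xs↭y∷ys sorted-x∷xs sorted-y∷ys =
        cong₂ _∷_ x≡y (linked-↭-unique (λ x∈ y∈ → antisym (there x∈) (there y∈)) xs↭ys
                         (Linked.tail sorted-x∷xs) (Linked.tail sorted-y∷ys))
        where
        y∈x∷xs : y ∈ x ∷ xs
        y∈x∷xs = ∈-resp-↭ (↭-sym x∷xs↭y∷ys) (here refl)
        x≡y : x ≡ y
        x≡y with linked-head sorted-y∷ys (∈-resp-↭ x∷xs↭y∷ys (here refl)) | linked-head sorted-x∷xs y∈x∷xs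
        ... | inj₁ x≡y | _ = x≡y
        ... | inj₂ _ | inj₁ y≡x = sym y≡x
        ... | inj₂ Ryx | inj₂ Rxy = antisym (here refl) y∈x∷xs Rxy Ryx
        xs↭ys : xs ↭ ys
        xs↭ys = drop-∷ (subst (λ z → x ∷ xs ↭ z ∷ ys) (sym x≡y) x∷xs↭y∷ys)

module _ {k : ℕ} where

  private
    2+2*m≤2*n : ∀ {m n} → m < n → 2 + 2 * m ≤ 2 * n
    2+2*m≤2*n {m} {n} m<n = subst (_≤ 2 * n) (*-suc 2 m) (*-monoʳ-≤ 2 m<n)

  hash<amp : ∀ (i : Fin k) → hash i <S amp i
  hash<amp i = n<1+n (2 * toℕ i)

  amp<hash : ∀ (i j : Fin k) → toℕ i < toℕ j → amp i <S hash j
  amp<hash _ _ = 2+2*m≤2*n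

  hash<hash : ∀ (i j : Fin k) → toℕ i < toℕ j → hash i <S hash j
  hash<hash i j i<j = <-trans (hash<amp i) (amp<hash i j i<j)

  amp<amp : ∀ (i j : Fin k) → toℕ i < toℕ j → amp i <S amp j
  amp<amp i j i<j = <-trans (amp<hash i j i<j) (hash<amp j)

  amp<a : ∀ (i : Fin k) → amp i <S a
  amp<a i = 2+2*m≤2*n (toℕ<n i)

  a<b : _<S_ {k} a b
  a<b = n<1+n (2 * k)

  <S⇒≢ : ∀ {c d : Sym k} → c <S d → c ≢ d
  <S⇒≢ c<d refl = <-irrefl refl c<d

  ==-refl : ∀ (c : Sym k) → (c == c) ≡ true
  ==-refl (hash i) with i Fin.≟ i
  ... | yes _ = refl
  ... | no i≢i = contradiction refl i≢i
  ==-refl (amp i) with i Fin.≟ i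
  ... | yes _ = refl
  ... | no i≢i = contradiction refl i≢i
  ==-refl a = refl
  ==-refl b = refl

  ==-false : ∀ {c d : Sym k} → c ≢ d → (c == d) ≡ false
  ==-false {hash i} {hash j} c≢d with i Fin.≟ j
  ... | yes refl = contradiction refl c≢d
  ... | no _ = refl
  ==-false {amp i} {amp j} c≢d with i Fin.≟ j
  ... | yes refl = contradiction refl c≢d
  ... | no _ = refl
  ==-false {a} {a} c≢d = contradiction refl c≢d
  ==-false {b} {b} c≢d = contradiction refl c≢d
  ==-false {hash _} {amp _} _ = refl
  ==-false {hash _} {a} _ = refl
  ==-false {hash _} {b} _ = refl
  ==-false {amp _} {hash _} _ = refl
  ==-false {amp _} {a} _ = refl
  ==-false {amp _} {b} _ = refl
  ==-false {a} {hash _} _ = refl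
  ==-false {a} {amp _} _ = refl
  ==-false {a} {b} _ = refl
  ==-false {b} {hash _} _ = refl
  ==-false {b} {amp _} _ = refl
  ==-false {b} {a} _ = refl

  _≈ω_ : Word k → Word k → Set
  x ≈ω y = ∀ i → omega x i ≡ omega y i

  nth-just⇒< : ∀ (x : Word k) {i c} → nth x i ≡ just c → i < length x
  nth-just⇒< (_ ∷ _) {zero} _ = z<s
  nth-just⇒< (_ ∷ x) {suc i} e = s<s (nth-just⇒< x e)

  nth⇒∈ : ∀ (x : Word k) {i c} → nth x i ≡ just c → c ∈ x
  nth⇒∈ (_ ∷ _) {zero} refl = here refl
  nth⇒∈ (_ ∷ x) {suc i} e = there (nth⇒∈ x e)

  ∈⇒nth : ∀ {x : Word k} {c} → c ∈ x → ∃[ i ] nth x i ≡ just c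
  ∈⇒nth (here refl) = 0 , refl
  ∈⇒nth (there c∈x) = let i , e = ∈⇒nth c∈x in suc i , e

  nth-++ˡ : ∀ (w : Word k) {x i} → i < length w → nth (w ++ x) i ≡ nth w i
  nth-++ˡ (_ ∷ _) {i = zero} _ = refl
  nth-++ˡ (_ ∷ w) {i = suc i} (s<s i<w) = nth-++ˡ w i<w

  nth-++ʳ : ∀ (w : Word k) {c x} → nth (w ++ c ∷ x) (length w) ≡ just c
  nth-++ʳ [] = refl
  nth-++ʳ (_ ∷ w) = nth-++ʳ w

  nth-ext : ∀ (x y : Word k) → length x ≡ length y → (∀ i → i < length x → nth x i ≡ nth y i) → x ≡ y
  nth-ext [] [] _ _ = refl
  nth-ext (c ∷ x) (d ∷ y) |x|≡|y| x≗y =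
    cong₂ _∷_ (just-injective (x≗y 0 z<s)) (nth-ext x y (suc-injective |x|≡|y|) (λ i → x≗y (suc i) ∘ s<s))

  omega-nth : ∀ (x : Word k) {i} → i < length x → omega x i ≡ nth x i
  omega-nth (c ∷ x) i<x = cong (nth (c ∷ x)) (m<n⇒m%n≡m i<x)

  nth⇒omega : ∀ (x : Word k) {i c} → nth x i ≡ just c → omega x i ≡ just c
  nth⇒omega x e = trans (omega-nth x (nth-just⇒< x e)) e

  omega⇒∈ : ∀ (x : Word k) {i c} → omega x i ≡ just c → c ∈ x
  omega⇒∈ (d ∷ x) {i} e = nth⇒∈ (d ∷ x) {i % suc (length x)} e

  ≤ω-++ : ∀ (w : Word k) {c d x y} → c <S d → (w ++ c ∷ x) ≤ω (w ++ d ∷ y)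
  ≤ω-++ w {c} {d} {x} {y} c<d =
    inj₂ (length w , agree , c , d , nth⇒omega (w ++ c ∷ x) (nth-++ʳ w) , nth⇒omega (w ++ d ∷ y) (nth-++ʳ w) , c<d)
    where
    omega-prefix : ∀ z {i} → i < length w → omega (w ++ z) i ≡ nth w i
    omega-prefix z i<w = trans (omega-nth (w ++ z) (<-≤-trans i<w (length-++-≤ˡ w))) (nth-++ˡ w i<w)
    agree : ∀ i → i < length w → omega (w ++ c ∷ x) i ≡ omega (w ++ d ∷ y) i
    agree i i<w = trans (omega-prefix _ i<w) (sym (omega-prefix _ i<w))

  ≤ω-singleton : ∀ {c d} {x : Word k} → d <S c → (c ∷ d ∷ x) ≤ω (c ∷ [])
  ≤ω-singleton {c} {d} d<c = inj₂ (1 , (λ { zero _ → refl ; (suc _) (s<s ()) }) , d , c , refl , refl , d<c)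

  ≤ω-resp : ∀ {x x′ y y′ : Word k} → x ≡ x′ → y ≡ y′ → x′ ≤ω y′ → x ≤ω y
  ≤ω-resp refl refl x≤y = x≤y

  ≤ω-trans : ∀ {x y z : Word k} → x ≤ω y → y ≤ω z → x ≤ω z
  ≤ω-trans (inj₁ x≈y) (inj₁ y≈z) = inj₁ (λ i → trans (x≈y i) (y≈z i))
  ≤ω-trans (inj₁ x≈y) (inj₂ (n , agree , c , d , ey , ez , c<d)) =
    inj₂ (n , (λ i i<n → trans (x≈y i) (agree i i<n)) , c , d , trans (x≈y n) ey , ez , c<d)
  ≤ω-trans (inj₂ (n , agree , c , d , ex , ey , c<d)) (inj₁ y≈z) =
    inj₂ (n , (λ i i<n → trans (agree i i<n) (y≈z i)) , c , d , ex , trans (sym (y≈z n)) ey , c<d)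
  ≤ω-trans (inj₂ (n , agree , c , d , ex , ey , c<d)) (inj₂ (n′ , agree′ , c′ , d′ , ey′ , ez′ , c′<d′))
    with <-cmp n n′
  ... | tri< n<n′ _ _ =
    inj₂ (n , (λ i i<n → trans (agree i i<n) (agree′ i (<-trans i<n n<n′))) , c , d ,
          ex , trans (sym (agree′ n n<n′)) ey , c<d)
  ... | tri≈ _ refl _ =
    inj₂ (n , (λ i i<n → trans (agree i i<n) (agree′ i i<n)) , c , d′ , ex , ez′ ,
          <-trans c<d (subst (_<S d′) (just-injective (trans (sym ey′) ey)) c′<d′))
  ... | tri> _ _ n′<n =
    inj₂ (n′ , (λ i i<n′ → trans (agree i (<-trans i<n′ n′<n)) (agree′ i i<n′)) , c′ , d′ ,
          trans (agree n′ n′<n) ey′ , ez′ , c′<d′)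

  ≤ω-antisym : ∀ {x y : Word k} → x ≤ω y → y ≤ω x → x ≈ω y
  ≤ω-antisym (inj₁ x≈y) _ = x≈y
  ≤ω-antisym (inj₂ _) (inj₁ y≈x) i = sym (y≈x i)
  ≤ω-antisym (inj₂ (n , agree , c , d , ex , ey , c<d)) (inj₂ (n′ , agree′ , c′ , d′ , ey′ , ex′ , c′<d′))
    with <-cmp n n′
  ... | tri< n<n′ _ _ =
    contradiction (just-injective (trans (sym ex) (trans (sym (agree′ n n<n′)) ey))) (<S⇒≢ c<d)
  ... | tri≈ _ refl _ =
    contradiction c<d (<-asym (subst₂ _<S_ (just-injective (trans (sym ey′) ey))
                                            (just-injective (trans (sym ex′) ex)) c′<d′))
  ... | tri> _ _ n′<n =
    contradiction (just-injective (trans (sym ey′) (trans (sym (agree n′ n′<n)) ex′))) (<S⇒≢ c′<d′)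

  ≈ω⇒≡ : ∀ {x y : Word k} → length x ≡ length y → x ≈ω y → x ≡ y
  ≈ω⇒≡ {x} {y} |x|≡|y| x≈y = nth-ext x y |x|≡|y| λ i i<x →
    trans (sym (omega-nth x i<x)) (trans (x≈y i) (omega-nth y (subst (i <_) |x|≡|y| i<x)))

  ≈ω-∈ : ∀ {x y : Word k} {c} → x ≈ω y → c ∈ y → c ∈ x
  ≈ω-∈ {x} {y} x≈y c∈y = let i , e = ∈⇒nth c∈y in omega⇒∈ x (trans (x≈y i) (nth⇒omega y e))

  rotate-++ : ∀ (xs ys : Word k) → rotate (length xs) (xs ++ ys) ≡ ys ++ xs
  rotate-++ xs ys = cong₂ _++_ (drop-length-++ xs) (take-length-++ xs)

  rotate-↭ : ∀ i (x : Word k) → rotate i x ↭ x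
  rotate-↭ i x = ↭-trans (++-comm (drop i x) (take i x)) (↭-reflexive (take++drop≡id i x))

  ¬<ₗ-descent : ∀ {c d} {x y : Word k} → d <S c → ¬ ((c ∷ x) <ₗ (d ∷ y))
  ¬<ₗ-descent d<c (hd< c<d) = <-asym c<d d<c
  ¬<ₗ-descent d<c (tl< _) = <-irrefl refl d<c

  private
    minimalHead-<ₗ : ∀ {c} {w x z : Word k} i → All (c <S_) w → i < length w → (c ∷ x) <ₗ (drop i w ++ z)
    minimalHead-<ₗ zero (c<d ∷ _) _ = hd< c<d
    minimalHead-<ₗ (suc i) (_ ∷ c<w) (s<s i<w) = minimalHead-<ₗ i c<w i<w

  lyndon-minimalHead : ∀ {c} {w : Word k} → All (c <S_) w → IsLyndon (c ∷ w)
  lyndon-minimalHead c<w = (λ ()) , λ { (suc i) _ (s<s i<w) → minimalHead-<ₗ i c<w i<w }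

  factorization-minimalHead : ∀ {c} {w : Word k} {fs} → All (c <S_) w →
    IsLyndonFactorization fs (c ∷ w) → fs ≡ (c ∷ w) ∷ []
  factorization-minimalHead {fs = []} _ (() , _)
  factorization-minimalHead {fs = f ∷ []} _ (f++[]≡cw , _) = cong [_] (trans (sym (++-identityʳ f)) f++[]≡cw)
  factorization-minimalHead {fs = [] ∷ _ ∷ _} _ (_ , (f≢[] , _) ∷ _ , _) = contradiction refl f≢[]
  factorization-minimalHead {fs = _ ∷ [] ∷ _} _ (_ , _ ∷ (g≢[] , _) ∷ _ , _) = contradiction refl g≢[]
  factorization-minimalHead {fs = (_ ∷ f) ∷ (_ ∷ _) ∷ _} c<w (refl , _ , f≮g ∷ _) =
    contradiction (hd< (All.lookup c<w (∈-++⁺ʳ f (here refl)))) f≮g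

  factorization-descent : ∀ {c d} {w : Word k} {fs} → d <S c → IsLyndonFactorization fs (c ∷ d ∷ w) →
    ∃[ gs ] fs ≡ [ c ] ∷ gs × IsLyndonFactorization gs (d ∷ w)
  factorization-descent {fs = []} _ (() , _)
  factorization-descent {fs = [] ∷ _} _ (_ , (f≢[] , _) ∷ _ , _) = contradiction refl f≢[]
  factorization-descent {fs = (_ ∷ []) ∷ gs} _ (concat≡ , _ ∷ lyndon-gs , sorted) =
    gs , cong (λ c → [ c ] ∷ gs) (∷-injectiveˡ concat≡) , ∷-injectiveʳ concat≡ , lyndon-gs , Linked.tail sorted
  factorization-descent {fs = (_ ∷ _ ∷ _) ∷ _} d<c (refl , (_ , f<rotations) ∷ _ , _) =
    contradiction (f<rotations 1 z<s (s<s z<s)) (¬<ₗ-descent d<c)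

  runs-replicate : ∀ c n (w : Word k) → runs (c ∷ replicate n c ++ w) ≡ runs (c ∷ w)
  runs-replicate c zero w = refl
  runs-replicate c (suc n) w rewrite ==-refl c = runs-replicate c n w

  runs-∷ : ∀ {c} {w : Word k} → All (c ≢_) w → runs (c ∷ w) ≡ suc (runs w)
  runs-∷ [] = refl
  runs-∷ {c} {d ∷ _} (c≢d ∷ _) rewrite ==-false c≢d = refl

  runs-increasing : ∀ {w : Word k} → Linked _<S_ w → runs w ≡ length w
  runs-increasing [] = refl
  runs-increasing [-] = refl
  runs-increasing {c ∷ d ∷ _} (c<d ∷ sorted) rewrite ==-false {c = c} {d} (<S⇒≢ c<d) =
    cong suc (runs-increasing sorted)

  runs-alternating : ∀ {n} (f : Fin n → Fin k) c (is : List (Fin n)) (w : Word k) →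
    runs (hash c ∷ concatMap (λ i → b ∷ hash (f i) ∷ []) is ++ a ∷ w) ≡ length is + length is + suc (runs (a ∷ w))
  runs-alternating f c [] w = refl
  runs-alternating f c (i ∷ is) w =
    trans (cong (suc ∘ suc) (runs-alternating f (f i) is w))
          (cong (λ n → suc (n + suc (runs (a ∷ w)))) (sym (+-suc (length is) (length is))))

  block : Fin k → Word k
  block i = b ∷ a ∷ hash i ∷ a ∷ amp i ∷ []

  length-blocks : ∀ {n} (f : Fin n → Fin k) → length (concatMap block (tabulate f)) ≡ n * 5
  length-blocks {zero} f = refl
  length-blocks {suc n} f = cong (5 +_) (length-blocks (f ∘ fsuc))

  last-blocks : ∀ {n} (f : Fin (suc n) → Fin k) → last (concatMap block (tabulate f)) ≡ just (amp (f (fromℕ n)))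
  last-blocks {zero} f = refl
  last-blocks {suc n} f =
    trans (last-++ (block (f fzero)) {concatMap block (tabulate (f ∘ fsuc))} (λ ())) (last-blocks (f ∘ fsuc))

  window-split : ∀ {n} (g : Fin (suc n) → Fin k) (j : Fin n) → ∃₂ λ P R →
    amp (g fzero) ∷ concatMap block (tabulate (g ∘ fsuc)) ≡ P ++ (amp (g (inject₁ j)) ∷ block (g (fsuc j))) ++ R
    × length P ≡ toℕ j * 5
  window-split g fzero = [] , _ , refl , refl
  window-split g (fsuc j) =
    let P , R , split , |P| = window-split (g ∘ fsuc) j
        Q = amp (g fzero) ∷ b ∷ a ∷ hash (g (fsuc fzero)) ∷ a ∷ []
    in Q ++ P , R , cong (Q ++_) split , cong (5 +_) |P|

v : (m : ℕ) → Word (suc m)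
v m = hash fzero ∷ a ∷ amp fzero ∷ concatMap block (tabulate fsuc)

last-v : ∀ m → last (v m) ≡ just (amp (fromℕ m))
last-v zero = refl
last-v (suc m) =
  trans (last-++ (hash fzero ∷ a ∷ amp fzero ∷ []) {concatMap block (tabulate fsuc)} (λ ())) (last-blocks fsuc)

module _ (m : ℕ) where

  private
    Wordₘ = Word (suc m)

  factors : List Wordₘ
  factors = [ b ] ∷ [ a ] ∷ v m ∷ []

  length-v : length (v m) ≡ 3 + m * 5
  length-v = cong (3 +_) (length-blocks {n = m} fsuc)

  rot : ℕ → Wordₘ
  rot i = rotate i (v m)

  -- The rotation of v starting at letter r of block fsuc j of u.
  tailRot : Fin m → ℕ → Wordₘ
  tailRot j r = rot (3 + (toℕ j * 5 + r))

  -- Block fsuc j of u with the letter preceding it: this fixes the first three letters and the last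
  -- letter of every tailRot j r.
  window : Fin m → Wordₘ
  window j = amp (inject₁ j) ∷ block (fsuc j)

  v-split : ∀ j → ∃₂ λ P R → v m ≡ P ++ window j ++ R × length P ≡ 2 + toℕ j * 5
  v-split j =
    let P , R , split , |P| = window-split id j
    in hash fzero ∷ a ∷ P , R , cong (λ w → hash fzero ∷ a ∷ w) split , cong (2 +_) |P|

  private
    tailRot-≡ : ∀ j r → r ≤ 5 → ∃₂ λ X Y →
      tailRot j r ≡ (drop (suc r) (window j) ++ X) ++ (Y ++ take (suc r) (window j))
    tailRot-≡ j r r≤5 with v-split j
    ... | P , R , v≡PWR , |P| = R , P , (begin
        tailRot j r
      ≡⟨ cong₂ rotate position v≡ ⟩
        rotate (length (P ++ take (suc r) W)) ((P ++ take (suc r) W) ++ (drop (suc r) W ++ R))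
      ≡⟨ rotate-++ (P ++ take (suc r) W) _ ⟩
        (drop (suc r) W ++ R) ++ (P ++ take (suc r) W) ∎)
      where
      open ≡-Reasoning
      W = window j
      |take| : length (take (suc r) W) ≡ suc r
      |take| = trans (length-take (suc r) W) (m≤n⇒m⊓n≡m (s≤s r≤5))
      position : 3 + (toℕ j * 5 + r) ≡ length (P ++ take (suc r) W)
      position = begin
          3 + (toℕ j * 5 + r)                 ≡⟨ cong (2 +_) (sym (+-suc (toℕ j * 5) r)) ⟩
          (2 + toℕ j * 5) + suc r             ≡⟨ sym (cong₂ _+_ |P| |take|) ⟩
          length P + length (take (suc r) W)  ≡⟨ sym (length-++ P) ⟩
          length (P ++ take (suc r) W)        ∎
      v≡ : v m ≡ (P ++ take (suc r) W) ++ (drop (suc r) W ++ R)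
      v≡ = begin
          v m                                            ≡⟨ v≡PWR ⟩
          P ++ W ++ R                                    ≡⟨ cong (λ w → P ++ w ++ R) (sym (take++drop≡id (suc r) W)) ⟩
          P ++ (take (suc r) W ++ drop (suc r) W) ++ R   ≡⟨ cong (P ++_) (++-assoc (take (suc r) W) _ R) ⟩
          P ++ take (suc r) W ++ drop (suc r) W ++ R     ≡⟨ sym (++-assoc P _ _) ⟩
          (P ++ take (suc r) W) ++ (drop (suc r) W ++ R) ∎

  tailRot-begins : ∀ j r {r≤5 : True (r ≤? 5)} → ∃[ X ] tailRot j r ≡ drop (suc r) (window j) ++ X
  tailRot-begins j r {r≤5} =
    let X , Y , eq = tailRot-≡ j r (toWitness r≤5)
    in X ++ Y ++ take (suc r) (window j) , trans eq (++-assoc (drop (suc r) (window j)) X _)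

  last-tailRot : ∀ j r {r≤5 : True (r ≤? 5)} → last (tailRot j r) ≡ last (take (suc r) (window j))
  last-tailRot j r {r≤5} =
    let X , Y , eq = tailRot-≡ j r (toWitness r≤5)
        D = drop (suc r) (window j) ++ X
    in trans (cong last (trans eq (sym (++-assoc D Y _)))) (last-++ (D ++ Y) (λ ()))

  hashAmpRots aRots baRots : List Wordₘ
  hashAmpRots = concat (tabulate (λ j → tailRot j 2 ∷ tailRot j 4 ∷ []))
  aRots = concat (tabulate (λ j → tailRot j 1 ∷ tailRot j 3 ∷ []))
  baRots = tabulate (λ j → tailRot j 0)

  sortedRots : List Wordₘ
  sortedRots = rot 0 ∷ rot 2 ∷ hashAmpRots ++ rot 1 ∷ aRots ++ [ a ] ∷ baRots ++ [ b ] ∷ []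

  -- _<S_ unfolds to a comparison of ranks, so the alphabet of a rank lemma has to be given explicitly
  -- when no letter index fixes it.
  sortedRots-linked : Linked _≤ω_ sortedRots
  sortedRots-linked =
    ≤ω-++ [] (hash<amp (fzero {m})) ∷
    linked-pairs (λ j → tailRot j 2) (λ j → tailRot j 4)
      (λ j → ≤ω-resp refl (starts j 2) (≤ω-++ [] (amp<hash fzero (fsuc j) z<s)))
      (λ j → ≤ω-resp (starts j 2) (starts j 4) (≤ω-++ [] (hash<amp (fsuc j))))
      (λ {i} {j} i<j → ≤ω-resp (starts i 4) (starts j 2) (≤ω-++ [] (amp<hash (fsuc i) (fsuc j) (s<s i<j))))
      (≤ω-++ [] (amp<a (fzero {m})) ∷ from-rot1)
      (λ j → ≤ω-resp (starts j 4) refl (≤ω-++ [] (amp<a (fsuc j))) ∷ from-rot1)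
    where
    starts : ∀ j r {r≤5 : True (r ≤? 5)} → tailRot j r ≡ drop (suc r) (window j) ++ _
    starts j r {r≤5} = proj₂ (tailRot-begins j r {r≤5})
    from-a : Linked _≤ω_ ([ a ] ∷ baRots ++ [ b ] ∷ [])
    from-a = linked-singles (λ j → tailRot j 0)
      (λ j → ≤ω-resp refl (starts j 0) (≤ω-++ [] (a<b {k = suc m})))
      (λ {i} {j} i<j → ≤ω-resp (starts i 0) (starts j 0) (≤ω-++ (b ∷ a ∷ []) (hash<hash (fsuc i) (fsuc j) (s<s i<j))))
      (≤ω-++ [] (a<b {k = suc m}) ∷ [-])
      (λ j → ≤ω-resp (starts j 0) refl (≤ω-singleton (a<b {k = suc m})) ∷ [-])
    from-rot1 : Linked _≤ω_ (rot 1 ∷ aRots ++ [ a ] ∷ baRots ++ [ b ] ∷ [])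
    from-rot1 = linked-pairs (λ j → tailRot j 1) (λ j → tailRot j 3)
      (λ j → ≤ω-resp refl (starts j 1) (≤ω-++ [ a ] (amp<hash fzero (fsuc j) z<s)))
      (λ j → ≤ω-resp (starts j 1) (starts j 3) (≤ω-++ [ a ] (hash<amp (fsuc j))))
      (λ {i} {j} i<j → ≤ω-resp (starts i 3) (starts j 1) (≤ω-++ [ a ] (amp<hash (fsuc i) (fsuc j) (s<s i<j))))
      (≤ω-singleton (amp<a (fzero {m})) ∷ from-a)
      (λ j → ≤ω-resp (starts j 3) refl (≤ω-singleton (amp<a (fsuc j))) ∷ from-a)

  rotations-v : rotations (v m) ≡ rot 0 ∷ rot 1 ∷ rot 2 ∷ applyUpTo (λ i → rot (3 + i)) (m * 5)
  rotations-v = trans (map-upTo rot (length (v m))) (cong (applyUpTo rot) length-v)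

  sortedRots↭ : sortedRots ↭ concatMap rotations factors
  sortedRots↭ = begin
      sortedRots
    ↭⟨ solve 8 (λ r₀ r₁ r₂ A B₁ B₂ C D →
                  r₀ ⊕ r₂ ⊕ A ⊕ r₁ ⊕ B₁ ⊕ B₂ ⊕ C ⊕ D ⊜ D ⊕ B₂ ⊕ r₀ ⊕ r₁ ⊕ r₂ ⊕ A ⊕ B₁ ⊕ C)
             ↭-refl [ rot 0 ] [ rot 1 ] [ rot 2 ] hashAmpRots aRots [ [ a ] ] baRots [ [ b ] ] ⟩
      [ b ] ∷ [ a ] ∷ rot 0 ∷ rot 1 ∷ rot 2 ∷ hashAmpRots ++ aRots ++ baRots
    ↭⟨ ++⁺ˡ ([ b ] ∷ [ a ] ∷ rot 0 ∷ rot 1 ∷ rot 2 ∷ []) (↭-sym (applyUpTo-blocks↭ (λ i → rot (3 + i)) m)) ⟩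
      [ b ] ∷ [ a ] ∷ rot 0 ∷ rot 1 ∷ rot 2 ∷ applyUpTo (λ i → rot (3 + i)) (m * 5)
    ≡⟨ cong (λ rs → [ b ] ∷ [ a ] ∷ rs) (sym (trans (++-identityʳ _) rotations-v)) ⟩
      concatMap rotations factors ∎
    where
    open PermutationReasoning
    open import Algebra.Solver.CommutativeMonoid (++-commutativeMonoid {A = Wordₘ}) using (solve; _⊕_; _⊜_)

  private
    LastIs : Wordₘ → Sym (suc m) → Set
    LastIs x c = last x ≡ just c

  sortedRots-lasts : Pointwise LastIs sortedRots (expectedBBWT m)
  sortedRots-lasts =
    trans (cong last (++-identityʳ (v m))) (last-v m) ∷
    last-++ (drop 2 (v m)) (λ ()) ∷
    Pointwise.++⁺ hashAmp-lasts (last-++ (drop 1 (v m)) (λ ()) ∷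
    Pointwise.++⁺ a-lasts (refl ∷
    Pointwise.++⁺ ba-lasts (refl ∷ [])))
    where
    hashAmp-lasts : Pointwise LastIs hashAmpRots (replicate (2 * m) a)
    hashAmp-lasts = subst (Pointwise LastIs hashAmpRots) (concat-pairs≡replicate m a)
      (Pointwise.concat⁺ (Pointwise.tabulate⁺ λ j → last-tailRot j 2 ∷ last-tailRot j 4 ∷ []))
    a-lasts : Pointwise LastIs aRots (concatMap (λ i → b ∷ hash (fsuc i) ∷ []) (allFin m))
    a-lasts = subst (Pointwise LastIs aRots ∘ concat) (sym (map-tabulate id (λ i → b ∷ hash (fsuc i) ∷ [])))
      (Pointwise.concat⁺ (Pointwise.tabulate⁺ λ j → last-tailRot j 1 ∷ last-tailRot j 3 ∷ []))
    ba-lasts : Pointwise LastIs baRots (map (λ i → amp (inject₁ i)) (allFin m))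
    ba-lasts = subst (Pointwise LastIs baRots) (sym (map-tabulate id (λ i → amp (inject₁ i))))
      (Pointwise.tabulate⁺ (λ j → last-tailRot j 0))

  map-last-sortedRots : map last sortedRots ≡ map just (expectedBBWT m)
  map-last-sortedRots = Pointwise-≡⇒≡ (Pointwise.map⁺ last just sortedRots-lasts)

  v-minimalHead : All (hash (fzero {m}) <S_) (a ∷ amp fzero ∷ concatMap block (tabulate fsuc))
  v-minimalHead =
    z<s ∷ z<s ∷
    All.concat⁺ (All.map⁺ {f = block} (All.tabulate⁺ {f = fsuc} (λ _ → z<s ∷ z<s ∷ z<s ∷ z<s ∷ z<s ∷ [])))

  factors-lyndon : IsLyndonFactorization factors (u m)
  factors-lyndon =
    cong (λ w → b ∷ a ∷ w) (++-identityʳ (v m)) ,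
    lyndon-minimalHead [] ∷ lyndon-minimalHead [] ∷ lyndon-minimalHead v-minimalHead ∷ [] ,
    ¬<ₗ-descent (a<b {k = suc m}) ∷ ¬<ₗ-descent {c = a} {d = hash fzero} z<s ∷ [-]

  factors-unique : ∀ {fs} → IsLyndonFactorization fs (u m) → fs ≡ factors
  factors-unique fs-lyndon with factorization-descent (a<b {k = suc m}) fs-lyndon
  ... | _ , refl , gs-lyndon with factorization-descent {c = a} {d = hash fzero} z<s gs-lyndon
  ... | _ , refl , hs-lyndon =
    cong (λ hs → [ b ] ∷ [ a ] ∷ hs) (factorization-minimalHead v-minimalHead hs-lyndon)

  Candidate : Wordₘ → Set
  Candidate x = (length x ≡ 1 × hash fzero ∉ x) ⊎ x ↭ v m

  candidate : ∀ {x} → x ∈ concatMap rotations factors → Candidate x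
  candidate (here refl) = inj₁ (refl , λ { (here ()) ; (there ()) })
  candidate (there (here refl)) = inj₁ (refl , λ { (here ()) ; (there ()) })
  candidate {x} (there (there x∈)) =
    let i , _ , x≡rot = ∈-map⁻ (λ i → rotate i (v m)) {xs = upTo (length (v m))}
                                (subst (x ∈_) (++-identityʳ (rotations (v m))) x∈)
    in inj₂ (subst (_↭ v m) (sym x≡rot) (rotate-↭ i (v m)))

  candidate-≈ω⇒≡ : ∀ {x y} → Candidate x → Candidate y → x ≈ω y → x ≡ y
  candidate-≈ω⇒≡ (inj₁ (|x|≡1 , _)) (inj₁ (|y|≡1 , _)) = ≈ω⇒≡ (trans |x|≡1 (sym |y|≡1))
  candidate-≈ω⇒≡ (inj₂ x↭v) (inj₂ y↭v) = ≈ω⇒≡ (trans (↭-length x↭v) (sym (↭-length y↭v)))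
  candidate-≈ω⇒≡ (inj₁ (_ , #∉x)) (inj₂ y↭v) x≈y =
    contradiction (≈ω-∈ x≈y (∈-resp-↭ (↭-sym y↭v) (here refl))) #∉x
  candidate-≈ω⇒≡ (inj₂ x↭v) (inj₁ (_ , #∉y)) x≈y =
    contradiction (≈ω-∈ (λ i → sym (x≈y i)) (∈-resp-↭ (↭-sym x↭v) (here refl))) #∉y

  u-BBWT : IsBBWT (u m) (expectedBBWT m)
  u-BBWT = factors , sortedRots , factors-lyndon , sortedRots↭ , sortedRots-linked , map-last-sortedRots

  u-BBWT-unique : ∀ out → IsBBWT (u m) out → out ≡ expectedBBWT m
  u-BBWT-unique out (fs , rs , fs-lyndon , rs↭ , rs-sorted , rs-lasts) with factors-unique fs-lyndon
  ... | refl = map-injective just-injective (begin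
        map just out               ≡⟨ sym rs-lasts ⟩
        map last rs                ≡⟨ cong (map last) (sym sortedRots≡rs) ⟩
        map last sortedRots        ≡⟨ map-last-sortedRots ⟩
        map just (expectedBBWT m)  ∎)
    where
    open ≡-Reasoning
    antisym : ∀ {x y} → x ∈ sortedRots → y ∈ sortedRots → x ≤ω y → y ≤ω x → x ≡ y
    antisym {x} {y} x∈ y∈ x≤y y≤x =
      candidate-≈ω⇒≡ (candidate (∈-resp-↭ sortedRots↭ x∈)) (candidate (∈-resp-↭ sortedRots↭ y∈))
                     (≤ω-antisym {x = x} {y} x≤y y≤x)
    sortedRots≡rs : sortedRots ≡ rs
    sortedRots≡rs = linked-↭-unique (λ {x y z} → ≤ω-trans {x = x} {y} {z}) antisym
                      (↭-trans sortedRots↭ (↭-sym rs↭)) sortedRots-linked rs-sorted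

  private
    amps : Wordₘ
    amps = map (λ i → amp (inject₁ i)) (allFin m)

  amps-b-increasing : Linked _<S_ (amps ++ [ b ])
  amps-b-increasing = subst (λ w → Linked _<S_ (w ++ [ b ])) (sym (map-tabulate id (λ i → amp (inject₁ i))))
    (AllPairs⇒Linked
      (AllPairs.++⁺ (AllPairs.tabulate⁺-< amps<amps) ([] AllPairs.∷ AllPairs.[]) (All.tabulate⁺ amps<b)))
    where
    amps<b : ∀ (i : Fin m) → All (amp (inject₁ i) <S_) [ b ]
    amps<b i = <-trans (amp<a (inject₁ i)) (a<b {k = suc m}) ∷ []
    amps<amps : ∀ {i j : Fin m} → i Fin.< j → amp (inject₁ i) <S amp (inject₁ j)
    amps<amps {i} {j} i<j =
      amp<amp (inject₁ i) (inject₁ j) (subst₂ _<_ (sym (toℕ-inject₁ i)) (sym (toℕ-inject₁ j)) i<j)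

  runs-expectedBBWT : runs (expectedBBWT m) ≡ 3 * suc m + 2
  runs-expectedBBWT = begin
      runs (expectedBBWT m)
    ≡⟨ cong suc (runs-replicate a (2 * m) _) ⟩
      suc (suc (runs (hash fzero ∷ concatMap (λ i → b ∷ hash (fsuc i) ∷ []) (allFin m) ++ a ∷ amps ++ [ b ])))
    ≡⟨ cong (suc ∘ suc) (runs-alternating fsuc fzero (allFin m) _) ⟩
      suc (suc (l + l + suc (runs (a ∷ amps ++ [ b ]))))
    ≡⟨ cong (λ r → suc (suc (l + l + suc r))) (trans (runs-∷ a∉) (cong suc (runs-increasing amps-b-increasing))) ⟩
      suc (suc (l + l + suc (suc (length (amps ++ [ b ])))))
    ≡⟨ cong₂ (λ p q → suc (suc (p + p + suc (suc q)))) |allFin| |amps-b| ⟩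
      suc (suc (m + m + suc (suc (m + 1))))
    ≡⟨ solve 1 (λ m → con 2 :+ (m :+ m :+ (con 2 :+ (m :+ con 1))) := con 3 :* (con 1 :+ m) :+ con 2) refl m ⟩
      3 * suc m + 2 ∎
    where
    open ≡-Reasoning
    open +-*-Solver
    l = length (allFin m)
    |allFin| : l ≡ m
    |allFin| = length-tabulate id
    |amps-b| : length (amps ++ [ b ]) ≡ m + 1
    |amps-b| = trans (length-++ amps) (cong (_+ 1) (trans (length-map _ (allFin m)) |allFin|))
    a∉ : All (a ≢_) (amps ++ [ b ])
    a∉ = All.++⁺ (All.map⁺ (All.tabulate⁺ {f = id} (λ _ ()))) ((λ ()) ∷ [])

lemma3p7 : (m : ℕ) →
    IsBBWT (u m) (expectedBBWT m)
    × (∀ out → IsBBWT (u m) out → out ≡ expectedBBWT m)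
    × runs (expectedBBWT m) ≡ 3 * suc m + 2
lemma3p7 m = u-BBWT m , u-BBWT-unique m , runs-expectedBBWT m
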